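{- (Deduction theorem.) If $T$ is a set of formulas, then $T\cup\{\alpha\}\vdash\beta$ if and only if $T\vdash\alpha\to\beta$.
   Context: Setting (PTEL). Formulas are built from propositional letters (including $A_a$, "agent $a$ is active", for each agent $a$ of a finite set $\mathcal A$) with $\neg,\wedge$, unary $\bigcirc$ (next), $\ominus$ (previous), $K_a$, $C$ (common knowledge), $P_{\geqslant s}$, $P_{a,\geqslant s}$ ($s$ rational in $[0,1]$) and binary $\mathsf U$ (until), $\mathsf S$ (since); $E\alpha=\bigwedge_aK_a\alpha$, $E^0\alpha=\alpha$, $E^{n+1}\alpha=EE^n\alpha$, $F\alpha=(\alpha\to\alpha)\mathsf U\alpha$, $P_{<s}\alpha=\neg P_{\geqslant s}\alpha$, $P_{\leqslant s}\alpha=P_{\geqslant1-s}\neg\alpha$ (analogously for $P_{a,\cdot}$). $k$-nested implications: for $\mathcal B=(\beta_0,\dots,\beta_k)$, $\mathcal X=(X_1,\dots,X_k)$ with $X_j\in\{K_a\}\cup\{\bigcirc,\ominus\}$: $N_0(\mathcal B,\mathcal X,\alpha)=\beta_0\to\alpha$, $N_k(\mathcal B,\mathcal X,\alpha)=\beta_k\to X_kN_{k-1}((\beta_0,\dots,\beta_{k-1}),(X_1,\dots,X_{k-1}),\alpha)$. Axiom system $\mathrm{Ax}$: propositional tautologies, modus ponens; temporal axioms $\neg\bigcirc\alpha\leftrightarrow\bigcirc\neg\alpha$, $\bigcirc(\alpha\to\beta)\to(\bigcirc\alpha\to\bigcirc\beta)$, $\alpha\mathsf U\beta\leftrightarrow\beta\vee(\alpha\wedge\bigcirc(\alpha\mathsf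 U\beta))$, $\alpha\mathsf U\beta\to F\beta$, $\neg\ominus\neg\alpha\to\ominus\alpha$, $\ominus(\alpha\to\beta)\to(\ominus\alpha\to\ominus\beta)$, $(\ominus\alpha\wedge\ominus\beta)\to\ominus(\alpha\wedge\beta)$, $\bigcirc\ominus\alpha\leftrightarrow\alpha$, $\bigcirc\ominus\alpha\to\ominus\bigcirc\alpha$, $\neg\ominus(\gamma\wedge\neg\gamma)\to(\bigcirc\ominus\alpha\leftrightarrow\ominus\bigcirc\alpha)$, $\alpha\mathsf S\beta\leftrightarrow[\beta\vee(\neg\ominus(\alpha\wedge\neg\alpha)\wedge[\alpha\wedge\ominus(\alpha\mathsf S\beta)])]$, $(\ominus\beta\to\ominus\beta)\,\mathsf S\,\ominus\beta$; necessitation for $\bigcirc,\ominus$; infinitary rules R$\mathsf U$ (from $N_k(\mathcal B,\mathcal X,\neg((\bigwedge_{l=0}^{i-1}\bigcirc^l\alpha)\wedge\bigcirc^i\beta))$ for all $i\in\mathbb N$ infer $N_k(\mathcal B,\mathcal X,\neg(\alpha\mathsf U\beta))$) and R$\mathsf S$ (from $N_k(\mathcal B,\mathcal X,\neg((\bigwedge_{l=0}^{i-1}\ominus^l\alpha)\wedge(\bigwedge_{l=0}^{i}\neg\ominus^l(\alpha\wedge\neg\alpha))\wedge\ominus^i\beta))$ for all $i$ infer $N_k(\mathcal B,\mathcal X,\neg(\alpha\mathsf S\beta))$); epistemic axioms $K_a(\alpha\to\beta)\to(K_a\alpha\to K_a\beta)$, $A_a\to(K_a\alpha\to\alpha)$,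 $A_a\to K_aA_a$, $\neg A_a\to K_a(\alpha\wedge\neg\alpha)$, $K_a\neg\alpha\to K_a\neg K_a\alpha$, $K_a\alpha\to K_aK_a\alpha$, $C\alpha\to E^m\alpha$, necessitation for $K_a$, rule RC (from $N_k(\mathcal B,\mathcal X,E^i\alpha)$ for all $i$ infer $N_k(\mathcal B,\mathcal X,C\alpha)$); probabilistic axioms for $P$: $P_{\geqslant0}\alpha$, $P_{\leqslant r}\alpha\to P_{<t}\alpha$ ($t>r$), $P_{<t}\alpha\to P_{\leqslant t}\alpha$, $(P_{\geqslant r}\alpha\wedge P_{\geqslant t}\beta\wedge P_{\geqslant1}\neg(\alpha\wedge\beta))\to P_{\geqslant\min(1,r+t)}(\alpha\vee\beta)$, $(P_{\leqslant r}\alpha\wedge P_{<t}\alpha)\to P_{<r+t}(\alpha\vee\beta)$ ($r+t\leqslant1$), $P_{\geqslant1}\ominus(\alpha\wedge\neg\alpha)$, necessitation $\alpha/P_{\geqslant1}\alpha$, Archimedean rule (from $N_k(\mathcal B,\mathcal X,P_{\geqslant r-1/i}\alpha)$ for all $i\geqslant1/r$ infer $N_k(\mathcal B,\mathcal X,P_{\geqslant r}\alpha)$, $r\in(0,1]\cap\mathbb Q$); the same for $P_{a,\cdot}$ except the axiom $P_{\geqslant1}\ominus(\alpha\wedge\neg\alpha)$. $T\vdash\alpha$ means there is a derivation of at most countable successor-ordinal length whose members are axioms, members of $T$, or obtained by rules from earlier members, where the necessitation rules for $\bigcirc,\ominus,K_a,P,P_a$ may only be applied to theorems. -}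

module Defs where

open import Data.Nat using (ℕ; zero; suc; z≤n)
open import Data.Fin using (Fin)
import Data.Fin as F
open import Data.Bool using (Bool; true; false; not; _∧_)
open import Data.Integer using (+_; +≤+)
open import Data.Rational using (ℚ; 0ℚ; 1ℚ; _/_; _-_; _+_; _*_; _⊓_; _≤_; _<_; *≤*)
open import Data.Product using (_×_)
open import Data.Sum using (_⊎_)
open import Relation.Binary.PropositionalEquality using (_≡_)

record U : Set where
  constructor mkU
  field
    val : ℚ
    .lo : 0ℚ ≤ val
    .hi : val ≤ 1ℚ
open U public

u0 : U
u0 = mkU 0ℚ (*≤* (+≤+ z≤n)) (*≤* (+≤+ z≤n))

u1 : U
u1 = mkU 1ℚ (*≤* (+≤+ z≤n)) (*≤* (+≤+ (Data.Nat.s≤s z≤n)))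

Agent : ℕ → Set
Agent n = Fin (suc n)

-- which probability operator: the global P or the agent's P_a
data PrOp (n : ℕ) : Set where
  global : PrOp n
  agent  : Agent n → PrOp n

data Form (n : ℕ) : Set where
  var  : ℕ → Form n               -- propositional letters other than the A_a
  act  : Agent n → Form n         -- A_a : "agent a is active"
  ¬'_  : Form n → Form n
  _∧'_ : Form n → Form n → Form n
  ○_   : Form n → Form n
  ⊖_   : Form n → Form n
  K    : Agent n → Form n → Form n
  C    : Form n → Form n
  Pr≥  : PrOp n → U → Form n → Form n   -- Pr≥ global s = P_{≥s}, Pr≥ (agent a) s = P_{a,≥s}
  _U'_ : Form n → Form n → Form n
  _S'_ : Form n → Form n → Form n

infixr 6 _∧'_
infix 7 ¬'_ ○_ ⊖_

module _ {n : ℕ} where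

  infixr 5 _∨'_
  infixr 4 _⇒_ _⇔'_

  _⇒_ : Form n → Form n → Form n
  a ⇒ b = ¬' (a ∧' ¬' b)

  _∨'_ : Form n → Form n → Form n
  a ∨' b = ¬' (¬' a ∧' ¬' b)

  _⇔'_ : Form n → Form n → Form n
  a ⇔' b = (a ⇒ b) ∧' (b ⇒ a)

  falsum : Form n → Form n
  falsum a = a ∧' ¬' a

  Fut : Form n → Form n
  Fut a = (a ⇒ a) U' a

  Pr< : PrOp n → U → Form n → Form n
  Pr< o s a = ¬' Pr≥ o s a

  Eall : ∀ {m} → (Fin (suc m) → Form n) → Form n
  Eall {zero}  f = f F.zero
  Eall {suc m} f = f F.zero ∧' Eall (λ i → f (F.suc i))

  E : Form n → Form n
  E a = Eall (λ i → K i a)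

  Epow : ℕ → Form n → Form n
  Epow zero    a = a
  Epow (suc m) a = E (Epow m a)

  iter : (Form n → Form n) → ℕ → Form n → Form n
  iter g zero    a = a
  iter g (suc m) a = g (iter g m a)

  bigAnd : (ℕ → Form n) → ℕ → Form n
  bigAnd f zero    = f zero
  bigAnd f (suc m) = bigAnd f m ∧' f (suc m)

  -- premise formulas of R U and R S (an empty conjunction is simply omitted)
  untilPrem : Form n → Form n → ℕ → Form n
  untilPrem a b zero    = ¬' (iter ○_ zero b)
  untilPrem a b (suc i) = ¬' (bigAnd (λ l → iter ○_ l a) i ∧' iter ○_ (suc i) b)

  sincePrem : Form n → Form n → ℕ → Form n
  sincePrem a b zero    =
    ¬' (bigAnd (λ l → ¬' iter ⊖_ l (falsum a)) zero ∧' iter ⊖_ zero b)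
  sincePrem a b (suc i) =
    ¬' ((bigAnd (λ l → iter ⊖_ l a) i ∧' bigAnd (λ l → ¬' iter ⊖_ l (falsum a)) (suc i))
        ∧' iter ⊖_ (suc i) b)

  data Op : Set where
    opK    : Agent n → Op
    opNext : Op
    opPrev : Op

  applyOp : Op → Form n → Form n
  applyOp (opK a) f = K a f
  applyOp opNext  f = ○ f
  applyOp opPrev  f = ⊖ f

  -- A nesting context: β₀ and the list ((X_k,β_k), …, (X_1,β_1)) (outermost first).
  data Nest : Set where
    base : Form n → Nest
    step : Form n → Op → Nest → Nest

  N : Nest → Form n → Form n
  N (base b)     a = b ⇒ a
  N (step b x ν) a = b ⇒ applyOp x (N ν a)

  -- Propositional tautologies: formulas true under every Boolean valuation
  -- of their maximal non-(¬,∧) subformulas.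

  evalP : (Form n → Bool) → Form n → Bool
  evalP v (¬' a)   = not (evalP v a)
  evalP v (a ∧' b) = evalP v a ∧ evalP v b
  evalP v f        = v f

  Tautology : Form n → Set
  Tautology f = (v : Form n → Bool) → evalP v f ≡ true

  data Axiom : Form n → Set where
    taut : ∀ {f} → Tautology f → Axiom f
    ax○¬   : ∀ a → Axiom (¬' (○ a) ⇔' ○ (¬' a))
    ax○K   : ∀ a b → Axiom (○ (a ⇒ b) ⇒ (○ a ⇒ ○ b))
    axUfix : ∀ a b → Axiom ((a U' b) ⇔' (b ∨' (a ∧' ○ (a U' b))))
    axUF   : ∀ a b → Axiom ((a U' b) ⇒ Fut b)
    ax⊖¬   : ∀ a → Axiom (¬' (⊖ (¬' a)) ⇒ ⊖ a)
    ax⊖K   : ∀ a b → Axiom (⊖ (a ⇒ b) ⇒ (⊖ a ⇒ ⊖ b))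
    ax⊖∧   : ∀ a b → Axiom ((⊖ a ∧' ⊖ b) ⇒ ⊖ (a ∧' b))
    ax○⊖   : ∀ a → Axiom (○ (⊖ a) ⇔' a)
    ax○⊖⊖○ : ∀ a → Axiom (○ (⊖ a) ⇒ ⊖ (○ a))
    ax⊖○   : ∀ g a → Axiom (¬' (⊖ (falsum g)) ⇒ (○ (⊖ a) ⇔' ⊖ (○ a)))
    axSfix : ∀ a b → Axiom ((a S' b) ⇔' (b ∨' (¬' (⊖ (falsum a)) ∧' (a ∧' ⊖ (a S' b)))))
    axSini : ∀ b → Axiom ((⊖ b ⇒ ⊖ b) S' (⊖ b))
    axKK   : ∀ i a b → Axiom (K i (a ⇒ b) ⇒ (K i a ⇒ K i b))
    axKT   : ∀ i a → Axiom (act i ⇒ (K i a ⇒ a))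
    axKA   : ∀ i → Axiom (act i ⇒ K i (act i))
    axK¬A  : ∀ i a → Axiom (¬' (act i) ⇒ K i (falsum a))
    axK5   : ∀ i a → Axiom (K i (¬' a) ⇒ K i (¬' (K i a)))
    axK4   : ∀ i a → Axiom (K i a ⇒ K i (K i a))
    axCE   : ∀ m a → Axiom (C a ⇒ Epow m a)
    -- probabilistic (for P and every P_a); P_{≤r}α = P_{≥1-r}¬α is written
    -- via r' with val r' ≡ 1 - val r.
    axP0   : ∀ o a → Axiom (Pr≥ o u0 a)
    axP≤<  : ∀ o a (r r' t : U) → val r' ≡ 1ℚ - val r → val r < val t →
             Axiom (Pr≥ o r' (¬' a) ⇒ Pr< o t a)
    axP<≤  : ∀ o a (t t' : U) → val t' ≡ 1ℚ - val t →
             Axiom (Pr< o t a ⇒ Pr≥ o t' (¬' a))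
    axPadd : ∀ o a b (r t u : U) → val u ≡ 1ℚ ⊓ (val r + val t) →
             Axiom ((Pr≥ o r a ∧' (Pr≥ o t b ∧' Pr≥ o u1 (¬' (a ∧' b)))) ⇒ Pr≥ o u (a ∨' b))
    axPsub : ∀ o a b (r r' t u : U) → val r' ≡ 1ℚ - val r → val u ≡ val r + val t →
             Axiom ((Pr≥ o r' (¬' a) ∧' Pr< o t b) ⇒ Pr< o u (a ∨' b))
    axPprev : ∀ a → Axiom (Pr≥ global u1 (⊖ (falsum a)))

  Theory : Set₁
  Theory = Form n → Set

  ∅ : Theory
  ∅ _ = Data.Empty.⊥
    where import Data.Empty

  _∪｛_｝ : Theory → Form n → Theory
  (T ∪｛ a ｝) f = T f ⊎ f ≡ a

  infix 2 _⊢_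

  data _⊢_ : Theory → Form n → Set₁ where
    byAx  : ∀ {T f} → Axiom f → T ⊢ f
    byHyp : ∀ {T f} → T f → T ⊢ f
    mp    : ∀ {T a b} → T ⊢ a → T ⊢ (a ⇒ b) → T ⊢ b
    nec○  : ∀ {T a} → ∅ ⊢ a → T ⊢ ○ a
    nec⊖  : ∀ {T a} → ∅ ⊢ a → T ⊢ ⊖ a
    necK  : ∀ {T a} i → ∅ ⊢ a → T ⊢ K i a
    necP  : ∀ {T a} o → ∅ ⊢ a → T ⊢ Pr≥ o u1 a
    ruleU : ∀ {T a b} ν → (∀ i → T ⊢ N ν (untilPrem a b i)) → T ⊢ N ν (¬' (a U' b))
    ruleS : ∀ {T a b} ν → (∀ i → T ⊢ N ν (sincePrem a b i)) → T ⊢ N ν (¬' (a S' b))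
    ruleC : ∀ {T a} ν → (∀ i → T ⊢ N ν (Epow i a)) → T ⊢ N ν (C a)
    -- Archimedean rule: indices i = suc j ≥ 1/r, i.e. i·r ≥ 1
    ruleArch : ∀ {T a} ν o (r : U) → 0ℚ < val r →
      (∀ (j : ℕ) (u : U) → 1ℚ ≤ (+ suc j / 1) * val r → val u ≡ val r - (+ 1 / suc j) →
         T ⊢ N ν (Pr≥ o u a)) →
      T ⊢ N ν (Pr≥ o r a)

-- The Hilbert-style argument: every axiom, hypothesis of T and conclusion of
-- a necessitation rule (which only acts on theorems) is weakened to α → _,
-- and modus ponens passes under α by the S-tautology. The infinitary rules
-- survive because their conclusions are nested implications
-- β_k → X_k(…): prefixing α amounts to replacing β_k by α ∧ β_k, which is
-- again an instance of the same rule.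
module Submission where

open import Defs
open import Data.Nat using (ℕ)
open import Data.Product using (_×_; _,_)
open import Data.Sum using (inj₁; inj₂)
open import Data.Bool using (Bool; true; false; not; _∧_)
open import Relation.Binary.PropositionalEquality using (_≡_; refl)

infixr 4 _→ᵇ_

_→ᵇ_ : Bool → Bool → Bool
x →ᵇ y = not (x ∧ not y)

→ᵇ-refl : ∀ x → (x →ᵇ x) ≡ true
→ᵇ-refl true  = refl
→ᵇ-refl false = refl

→ᵇ-const : ∀ x y → (x →ᵇ y →ᵇ x) ≡ true
→ᵇ-const true  true  = refl
→ᵇ-const true  false = refl
→ᵇ-const false _     = refl

→ᵇ-S : ∀ x y z → ((x →ᵇ y) →ᵇ (x →ᵇ y →ᵇ z) →ᵇ x →ᵇ z) ≡ true
→ᵇ-S true  true  true  = refl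
→ᵇ-S true  true  false = refl
→ᵇ-S true  false _     = refl
→ᵇ-S false _     _     = refl

→ᵇ-uncurry : ∀ x y z → ((x →ᵇ y →ᵇ z) →ᵇ (x ∧ y) →ᵇ z) ≡ true
→ᵇ-uncurry true  true  true  = refl
→ᵇ-uncurry true  true  false = refl
→ᵇ-uncurry true  false _     = refl
→ᵇ-uncurry false _     _     = refl

→ᵇ-curry : ∀ x y z → (((x ∧ y) →ᵇ z) →ᵇ x →ᵇ y →ᵇ z) ≡ true
→ᵇ-curry true  true  true  = refl
→ᵇ-curry true  true  false = refl
→ᵇ-curry true  false _     = refl
→ᵇ-curry false _     _     = refl

module _ {n : ℕ} where

  ⊢-refl : ∀ {T} (α : Form n) → T ⊢ α ⇒ α
  ⊢-refl α = byAx (taut λ v → →ᵇ-refl (evalP v α))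

  ⊢-const : ∀ {T} (α : Form n) {φ} → T ⊢ φ → T ⊢ α ⇒ φ
  ⊢-const α {φ} d = mp d (byAx (taut λ v → →ᵇ-const (evalP v φ) (evalP v α)))

  ⊢-S : ∀ {T} {α φ ψ : Form n} → T ⊢ α ⇒ φ → T ⊢ α ⇒ (φ ⇒ ψ) → T ⊢ α ⇒ ψ
  ⊢-S {α = α} {φ} {ψ} d e =
    mp e (mp d (byAx (taut λ v → →ᵇ-S (evalP v α) (evalP v φ) (evalP v ψ))))

  ⊢-uncurry : ∀ {T} {α β φ : Form n} → T ⊢ α ⇒ (β ⇒ φ) → T ⊢ (α ∧' β) ⇒ φ
  ⊢-uncurry {α = α} {β} {φ} d =
    mp d (byAx (taut λ v → →ᵇ-uncurry (evalP v α) (evalP v β) (evalP v φ)))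

  ⊢-curry : ∀ {T} {α β φ : Form n} → T ⊢ (α ∧' β) ⇒ φ → T ⊢ α ⇒ (β ⇒ φ)
  ⊢-curry {α = α} {β} {φ} d =
    mp d (byAx (taut λ v → →ᵇ-curry (evalP v α) (evalP v β) (evalP v φ)))

  ⊢-mono : ∀ {S T : Theory} {φ : Form n} → (∀ {ψ} → S ψ → T ψ) → S ⊢ φ → T ⊢ φ
  ⊢-mono S⊆T (byAx ax)               = byAx ax
  ⊢-mono S⊆T (byHyp h)               = byHyp (S⊆T h)
  ⊢-mono S⊆T (mp d e)                = mp (⊢-mono S⊆T d) (⊢-mono S⊆T e)
  ⊢-mono S⊆T (nec○ d)                = nec○ d
  ⊢-mono S⊆T (nec⊖ d)                = nec⊖ d
  ⊢-mono S⊆T (necK i d)              = necK i d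
  ⊢-mono S⊆T (necP o d)              = necP o d
  ⊢-mono S⊆T (ruleU ν ds)            = ruleU ν λ i → ⊢-mono S⊆T (ds i)
  ⊢-mono S⊆T (ruleS ν ds)            = ruleS ν λ i → ⊢-mono S⊆T (ds i)
  ⊢-mono S⊆T (ruleC ν ds)            = ruleC ν λ i → ⊢-mono S⊆T (ds i)
  ⊢-mono S⊆T (ruleArch ν o r r>0 ds) =
    ruleArch ν o r r>0 λ j u ju≥1 u≡ → ⊢-mono S⊆T (ds j u ju≥1 u≡)

  _∧ᴺ_ : Form n → Nest → Nest
  α ∧ᴺ base β     = base (α ∧' β)
  α ∧ᴺ step β X ν = step (α ∧' β) X ν

  ⇒N→∧ᴺ : ∀ {T} {α φ : Form n} ν → T ⊢ α ⇒ N ν φ → T ⊢ N (α ∧ᴺ ν) φ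
  ⇒N→∧ᴺ (base _)     = ⊢-uncurry
  ⇒N→∧ᴺ (step _ _ _) = ⊢-uncurry

  ∧ᴺ→⇒N : ∀ {T} {α φ : Form n} ν → T ⊢ N (α ∧ᴺ ν) φ → T ⊢ α ⇒ N ν φ
  ∧ᴺ→⇒N (base _)     = ⊢-curry
  ∧ᴺ→⇒N (step _ _ _) = ⊢-curry

  deduction : ∀ {T} {α φ : Form n} → T ∪｛ α ｝ ⊢ φ → T ⊢ α ⇒ φ
  deduction {α = α} (byAx ax)           = ⊢-const α (byAx ax)
  deduction {α = α} (byHyp (inj₁ h))    = ⊢-const α (byHyp h)
  deduction {α = α} (byHyp (inj₂ refl)) = ⊢-refl α
  deduction         (mp d e)            = ⊢-S (deduction d) (deduction e)
  deduction {α = α} (nec○ d)            = ⊢-const α (nec○ d)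
  deduction {α = α} (nec⊖ d)            = ⊢-const α (nec⊖ d)
  deduction {α = α} (necK i d)          = ⊢-const α (necK i d)
  deduction {α = α} (necP o d)          = ⊢-const α (necP o d)
  deduction (ruleU ν ds) =
    ∧ᴺ→⇒N ν (ruleU _ λ i → ⇒N→∧ᴺ ν (deduction (ds i)))
  deduction (ruleS ν ds) =
    ∧ᴺ→⇒N ν (ruleS _ λ i → ⇒N→∧ᴺ ν (deduction (ds i)))
  deduction (ruleC ν ds) =
    ∧ᴺ→⇒N ν (ruleC _ λ i → ⇒N→∧ᴺ ν (deduction (ds i)))
  deduction (ruleArch ν o r r>0 ds) =
    ∧ᴺ→⇒N ν (ruleArch _ o r r>0 λ j u ju≥1 u≡ → ⇒N→∧ᴺ ν (deduction (ds j u ju≥1 u≡)))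

  deduction⁻¹ : ∀ {T} {α φ : Form n} → T ⊢ α ⇒ φ → T ∪｛ α ｝ ⊢ φ
  deduction⁻¹ d = mp (byHyp (inj₂ refl)) (⊢-mono inj₁ d)

theorem1 : (n : ℕ) (T : Form n → Set) (α β : Form n) →
    ((T ∪｛ α ｝ ⊢ β) → (T ⊢ (α ⇒ β))) × ((T ⊢ (α ⇒ β)) → (T ∪｛ α ｝ ⊢ β))
theorem1 n T α β = deduction , deduction⁻¹
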